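{- Let $f:\{0,1\}^n\to\{0,1\}^n$ be a monotone Boolean network with interaction graph $G$. If the set of fixed points of $f$ has a $k$-pattern, then $G$ has $k$ vertex-disjoint cycles.
   Context: $f$ is monotone if $x\le y\Rightarrow f(x)\le f(y)$ (componentwise). The interaction graph has vertex set $[n]$ and arc $uv$ (loops allowed) iff $f_v$ depends on $x_u$; cycles are directed without repeated vertices. A $k$-pattern of $P\subseteq\{0,1\}^n$ is a pair of sequences $(x^1,\dots,x^k)$, $(y^1,\dots,y^k)$, each of $k$ distinct elements of $P$, with $x^p\le y^q$ iff $p\ne q$, for all $p,q\in[k]$. -}

module Defs where

open import Data.Nat using (ℕ)
open import Data.Bool using (Bool; not) renaming (_≤_ to _≤ᵇ_)
open import Data.Fin using (Fin; _≟_)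
open import Data.List using (List; []; _∷_; _++_)
open import Data.List.Relation.Unary.Unique.Propositional using (Unique)
open import Data.List.Membership.Propositional using (_∈_; _∉_)
open import Data.Product using (Σ; _×_; ∃)
open import Data.Unit using (⊤)
open import Data.Empty using (⊥)
open import Function.Definitions using (Injective)
open import Relation.Binary.PropositionalEquality using (_≡_; _≢_)
open import Relation.Nullary using (yes; no)
open import Function.Bundles using (_⇔_)

Config : ℕ → Set
Config n = Fin n → Bool

BN : ℕ → Set
BN n = Config n → Config n

_≤c_ : ∀ {n} → Config n → Config n → Set
x ≤c y = ∀ i → x i ≤ᵇ y i

Monotone : ∀ {n} → BN n → Set
Monotone f = ∀ x y → x ≤c y → f x ≤c f y

flipAt : ∀ {n} → Fin n → Config n → Config n
flipAt u x i with i ≟ u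
... | yes _ = not (x i)
... | no  _ = x i

-- arc u → v of the interaction graph: f_v depends on x_u
Arc : ∀ {n} → BN n → Fin n → Fin n → Set
Arc f u v = ∃ λ x → f x v ≢ f (flipAt u x) v

Chain : ∀ {n} → BN n → List (Fin n) → Set
Chain f []            = ⊤
Chain f (a ∷ [])      = ⊤
Chain f (a ∷ b ∷ r)   = Arc f a b × Chain f (b ∷ r)

-- a (directed) cycle v₀ → v₁ → … → v_{m-1} → v₀, vertices pairwise distinct, m ≥ 1
-- (m = 1 is a loop)
IsCycle : ∀ {n} → BN n → List (Fin n) → Set
IsCycle f []       = ⊥
IsCycle f (v ∷ vs) = Unique (v ∷ vs) × Chain f ((v ∷ vs) ++ (v ∷ []))

HasDisjointCycles : ∀ {n} → BN n → ℕ → Set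
HasDisjointCycles {n} f k =
  Σ (Fin k → List (Fin n)) λ C →
    (∀ i → IsCycle f (C i)) ×
    (∀ i j → i ≢ j → ∀ v → v ∈ C i → v ∉ C j)

Fixed : ∀ {n} → BN n → Config n → Set
Fixed f x = f x ≡ x

HasPattern : ∀ {n} → (Config n → Set) → ℕ → Set
HasPattern {n} P k =
  Σ (Fin k → Config n) λ x → Σ (Fin k → Config n) λ y →
    Injective _≡_ _≡_ x × Injective _≡_ _≡_ y ×
    (∀ p → P (x p)) × (∀ q → P (y q)) ×
    (∀ p q → (x p ≤c y q) ⇔ (p ≢ q))

-- For a pattern (x¹…xᵏ, y¹…yᵏ) of fixed points let Sₚ be the set of coordinates where
-- xᵖ is 1 and yᵖ is 0. It is nonempty because xᵖ ≰ yᵖ, and Sₚ, S_q are disjoint for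
-- p ≠ q because xᵖ ≤ y^q. Every i ∈ Sₚ has an in-neighbour in Sₚ: raising the coordinates
-- of Sₚ one at a time leads from yᵖ to a configuration above xᵖ, so by monotonicity fᵢ
-- goes from 0 to 1 along the way, and the coordinate whose flip changes fᵢ is such an
-- in-neighbour. Walking backwards inside Sₚ must close a cycle, giving k disjoint cycles.
module Submission where

open import Defs
open import Data.Nat using (ℕ; zero; suc; _+_; _<_; _≤_; _≤?_)
open import Data.Nat.Properties using (≰⇒>; <⇒≱; +-suc; +-identityʳ; n<1+n)
open import Data.Bool using (true; false; not; b≤b) renaming (_≤_ to _≤ᵇ_)
open import Data.Bool.Properties using (≤-minimum; ≤-maximum) renaming (_≟_ to _≟ᵇ_; _≤?_ to _≤ᵇ?_)
open import Data.Fin using (Fin; _≟_; zero; suc)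
open import Data.Fin.Properties using (pigeonhole; ¬∀⟶∃¬) renaming (<⇒≢ to <⇒≢ᶠ)
open import Data.List using (List; []; _∷_; _++_; length; lookup; allFin; filter)
open import Data.List.Relation.Unary.All as All using (All; []; _∷_)
open import Data.List.Relation.Unary.AllPairs using ([]; _∷_)
open import Data.List.Relation.Unary.All.Properties using (¬Any⇒All¬; All¬⇒¬Any)
open import Data.List.Relation.Unary.Any using (here; there)
open import Data.List.Relation.Unary.Unique.Propositional using (Unique)
open import Data.List.Relation.Unary.Unique.Propositional.Properties using (filter⁺; allFin⁺)
open import Data.List.Relation.Binary.Subset.Propositional using (_⊆_)
open import Data.List.Membership.Propositional using (_∈_; _∉_)
open import Data.List.Membership.Propositional.Properties using (∈-lookup; ∈-allFin; ∈-filter⁺; ∈-filter⁻)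
open import Data.Product using (∃; _×_; _,_; proj₁; proj₂)
open import Data.Unit using (tt)
open import Function using (_∘_)
open import Function.Bundles using (Equivalence)
open import Relation.Binary.PropositionalEquality using (_≡_; _≢_; refl; sym; trans; cong; cong-app; subst; ≢-sym)
open import Relation.Nullary using (¬_; yes; no; contradiction)
open import Relation.Nullary.Decidable using (_×-dec_)
open import Relation.Unary using (Decidable)

lookup-injective : ∀ {A : Set} {xs : List A} → Unique xs →
  ∀ i j → lookup xs i ≡ lookup xs j → i ≡ j
lookup-injective (_ ∷ _) zero zero _ = refl
lookup-injective (x≢ ∷ _) zero (suc j) eq = contradiction eq (All.lookup x≢ (∈-lookup j))
lookup-injective (x≢ ∷ _) (suc i) zero eq = contradiction (sym eq) (All.lookup x≢ (∈-lookup i))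
lookup-injective (_ ∷ u) (suc i) (suc j) eq = cong suc (lookup-injective u i j eq)

unique⇒length≤ : ∀ {n} {xs : List (Fin n)} → Unique xs → length xs ≤ n
unique⇒length≤ {n} {xs} u with length xs ≤? n
... | yes ≤n = ≤n
... | no ≰n with pigeonhole (≰⇒> ≰n) (lookup xs)
...   | i , j , i<j , eq = contradiction (lookup-injective u i j eq) (<⇒≢ᶠ i<j)

true≤⇒≡true : ∀ {b} → true ≤ᵇ b → b ≡ true
true≤⇒≡true b≤b = refl

module _ {n : ℕ} where

  flipAt-self : ∀ u (c : Config n) → flipAt u c u ≡ not (c u)
  flipAt-self u c with u ≟ u
  ... | yes _ = refl
  ... | no u≢u = contradiction refl u≢u

  flipAt-other : ∀ {u j} (c : Config n) → j ≢ u → flipAt u c j ≡ c j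
  flipAt-other {u} {j} c j≢u with j ≟ u
  ... | yes j≡u = contradiction j≡u j≢u
  ... | no _ = refl

  flipAll : List (Fin n) → Config n → Config n
  flipAll [] c = c
  flipAll (u ∷ us) c = flipAll us (flipAt u c)

  flipAll-∉ : ∀ {us j} (c : Config n) → j ∉ us → flipAll us c j ≡ c j
  flipAll-∉ {[]} c _ = refl
  flipAll-∉ {u ∷ us} c j∉ = trans (flipAll-∉ (flipAt u c) (j∉ ∘ there)) (flipAt-other c (j∉ ∘ here))

  flipAll-∈ : ∀ {us j} (c : Config n) → Unique us → j ∈ us → flipAll us c j ≡ not (c j)
  flipAll-∈ {u ∷ us} c (u≢ ∷ _) (here refl) =
    trans (flipAll-∉ (flipAt u c) (All¬⇒¬Any u≢)) (flipAt-self u c)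
  flipAll-∈ {u ∷ us} c (u≢ ∷ uq) (there j∈) =
    trans (flipAll-∈ (flipAt u c) uq j∈) (cong not (flipAt-other c (≢-sym (All.lookup u≢ j∈))))

  Gap : Config n → Config n → Fin n → Set
  Gap x y j = x j ≡ true × y j ≡ false

  gap? : ∀ x y → Decidable (Gap x y)
  gap? x y j = (x j ≟ᵇ true) ×-dec (y j ≟ᵇ false)

  ¬gap⇒≤ : ∀ {x y : Config n} {j} → ¬ Gap x y j → x j ≤ᵇ y j
  ¬gap⇒≤ {x} {y} {j} ¬gap with x j | y j
  ... | false | b = ≤-minimum b
  ... | true | true = b≤b
  ... | true | false = contradiction (refl , refl) ¬gap

  ≰⇒gap : ∀ {x y : Config n} → ¬ x ≤c y → ∃ (Gap x y)
  ≰⇒gap {x} {y} x≰y with ¬∀⟶∃¬ n _ (λ j → x j ≤ᵇ? y j) x≰y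
  ... | j , xj≰yj with gap? x y j
  ...   | yes gap = j , gap
  ...   | no ¬gap = contradiction (¬gap⇒≤ {x} {y} ¬gap) xj≰yj

  ≤⇒¬gap : ∀ {x y : Config n} {j} → x ≤c y → ¬ Gap x y j
  ≤⇒¬gap {x} {y} {j} x≤y (xj , yj) with trans (sym yj) (true≤⇒≡true (subst (_≤ᵇ y j) xj (x≤y j)))
  ... | ()

  gapList : Config n → Config n → List (Fin n)
  gapList x y = filter (gap? x y) (allFin n)

  gapList-unique : ∀ x y → Unique (gapList x y)
  gapList-unique x y = filter⁺ (gap? x y) (allFin⁺ n)

  ∈-gapList⁺ : ∀ {x y j} → Gap x y j → j ∈ gapList x y
  ∈-gapList⁺ {x} {y} {j} = ∈-filter⁺ (gap? x y) (∈-allFin j)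

  ∈-gapList⁻ : ∀ {x y j} → j ∈ gapList x y → Gap x y j
  ∈-gapList⁻ {x} {y} = proj₂ ∘ ∈-filter⁻ (gap? x y) {xs = allFin n}

  ≤-flipAll-gapList : ∀ (x y : Config n) → x ≤c flipAll (gapList x y) y
  ≤-flipAll-gapList x y j with gap? x y j
  ... | yes gap@(_ , yj) =
    subst (x j ≤ᵇ_) (sym (trans (flipAll-∈ y (gapList-unique x y) (∈-gapList⁺ gap)) (cong not yj)))
      (≤-maximum (x j))
  ... | no ¬gap = subst (x j ≤ᵇ_) (sym (flipAll-∉ y (¬gap ∘ ∈-gapList⁻))) (¬gap⇒≤ {x} {y} ¬gap)

module _ {n : ℕ} (f : BN n) where

  open import Data.List.Membership.DecPropositional (_≟_ {n}) using (_∈?_)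

  flipAll-arc : ∀ us (c : Config n) {i} → f c i ≢ f (flipAll us c) i → ∃ λ u → u ∈ us × Arc f u i
  flipAll-arc [] c changed = contradiction refl changed
  flipAll-arc (u ∷ us) c {i} changed with f c i ≟ᵇ f (flipAt u c) i
  ... | no u-changes = u , here refl , c , u-changes
  ... | yes same with flipAll-arc us (flipAt u c) (changed ∘ trans same)
  ...   | v , v∈ , arc = v , there v∈ , arc

  gap-predecessor : Monotone f → ∀ {x y} → Fixed f x → Fixed f y →
    ∀ {i} → Gap x y i → ∃ λ u → Gap x y u × Arc f u i
  gap-predecessor mono {x} {y} fx fy {i} (xi , yi)
    with flipAll-arc (gapList x y) y f-changes
    where
    z = flipAll (gapList x y) y
    fyi : f y i ≡ false
    fyi = trans (cong-app fy i) yi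
    fzi : f z i ≡ true
    fzi = true≤⇒≡true (subst (_≤ᵇ f z i) (trans (cong-app fx i) xi) (mono x z (≤-flipAll-gapList x y) i))
    f-changes : f y i ≢ f z i
    f-changes eq with trans (sym fyi) (trans eq fzi)
    ... | ()
  ... | u , u∈ , arc = u , ∈-gapList⁻ u∈ , arc

  close-at : ∀ {u h a Q} → u ∈ a ∷ Q → Unique (a ∷ Q) → Chain f (a ∷ Q) → Arc f u h →
    ∃ λ R → Unique (a ∷ R) × Chain f ((a ∷ R) ++ h ∷ []) × (a ∷ R) ⊆ (a ∷ Q)
  close-at (here refl) _ _ arc = [] , [] ∷ [] , (arc , tt) , λ { (here e) → here e ; (there ()) }
  close-at {Q = b ∷ Q} (there u∈) (a≢ ∷ uq) (a→b , ch) arc with close-at u∈ uq ch arc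
  ... | R , uqR , chR , R⊆ =
    b ∷ R , All.tabulate (All.lookup a≢ ∘ R⊆) ∷ uqR , (a→b , chR) ,
      λ { (here e) → here e ; (there v∈) → there (R⊆ v∈) }

  CycleIn : (Fin n → Set) → Set
  CycleIn S = ∃ λ C → IsCycle f C × All S C

  module _ {S : Fin n → Set} (pred : ∀ {i} → S i → ∃ λ u → S u × Arc f u i) where

    -- h ∷ P is a path h → … traced backwards; the fuel is exhausted only past n vertices.
    extend : ∀ fuel {h P} → Unique (h ∷ P) → Chain f (h ∷ P) → All S (h ∷ P) →
      n < length (h ∷ P) + fuel → CycleIn S
    extend zero {h} {P} uq _ _ bound =
      contradiction (unique⇒length≤ uq) (<⇒≱ (subst (n <_) (+-identityʳ (length (h ∷ P))) bound))
    extend (suc fuel) {h} {P} uq ch inS bound with pred (All.head inS)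
    ... | u , u∈S , u→h with u ∈? h ∷ P
    ...   | no u∉ = extend fuel (¬Any⇒All¬ _ u∉ ∷ uq) (u→h , ch) (u∈S ∷ inS)
                      (subst (n <_) (+-suc (length (h ∷ P)) fuel) bound)
    ...   | yes u∈ with close-at u∈ uq ch u→h
    ...     | R , uqR , chR , R⊆ = h ∷ R , (uqR , chR) , All.tabulate (All.lookup inS ∘ R⊆)

    cycle-in : ∀ {i} → S i → CycleIn S
    cycle-in si = extend n ([] ∷ []) tt (si ∷ []) (n<1+n n)

lemma4 : ∀ (n k : ℕ) (f : BN n) → Monotone f →
    HasPattern (Fixed f) k → HasDisjointCycles f k
lemma4 n k f mono (x , y , _ , _ , fixedˣ , fixedʸ , ≤⇔≢) = C , isCycle , disjoint
  where
  open Equivalence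

  cycle : ∀ p → CycleIn f (Gap (x p) (y p))
  cycle p = cycle-in f (gap-predecessor f mono (fixedˣ p) (fixedʸ p))
    (proj₂ (≰⇒gap (λ x≤y → to (≤⇔≢ p p) x≤y refl)))

  C : Fin k → List (Fin n)
  C p = proj₁ (cycle p)

  isCycle : ∀ p → IsCycle f (C p)
  isCycle p = proj₁ (proj₂ (cycle p))

  disjoint : ∀ p q → p ≢ q → ∀ v → v ∈ C p → v ∉ C q
  disjoint p q p≢q v v∈p v∈q =
    ≤⇒¬gap (from (≤⇔≢ p q) p≢q)
      (proj₁ (All.lookup (proj₂ (proj₂ (cycle p))) v∈p) , proj₂ (All.lookup (proj₂ (proj₂ (cycle q))) v∈q))
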